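{- Let $K$ be a Kleene algebra and $x\in K$. Then $\{y\in K : y\le x\}$ is a subalgebra of $K$ if and only if $x=y^*$ for some $y\in K$ (equivalently, $x=x^*$). The same statement holds when $K$ is a Kleene algebra with tests.
   Context: An idempotent semiring is a structure $(S,+,\cdot,0,1)$ where $(S,+,0)$ is a commutative idempotent monoid (so $x\le y :\iff x+y=y$ is a partial order), $(S,\cdot,1)$ is a monoid, $0$ is a two-sided annihilator for $\cdot$, and $\cdot$ distributes over $+$ on both sides. A Kleene algebra is a structure $(K,+,\cdot,{}^*,0,1)$ which is an idempotent semiring and satisfies $1+xx^*\le x^*$, $1+x^*x\le x^*$, $p+qx\le x\rightarrow q^*p\le x$, and $p+xq\le x\rightarrow pq^*\le x$. A Kleene algebra with tests is a two-sorted structure $(K,B,+,\cdot,{}^*,\overline{\phantom{x}},0,1)$ where $(K,+,\cdot,{}^*,0,1)$ is a Kleene algebra and $B\subseteq K$ with $(B,+,\cdot,\overline{\phantom{x}},0,1)$ a Boolean algebra. A subalgebra is a subset containing $0,1$ and closed under all the operations (for a KAT, with test sort the intersection with $B$). -}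

module Defs where

open import Level using (Level; suc; _⊔_)
open import Data.Product using (Σ; _×_)
open import Relation.Binary.PropositionalEquality using (_≡_)
open import Function using (Injective)
import Algebra.Lattice.Structures as LS

record IdempotentSemiring (c : Level) : Set (suc c) where
  infixl 6 _+_
  infixl 7 _·_
  field
    Carrier : Set c
    _+_ _·_ : Carrier → Carrier → Carrier
    𝟎 𝟏     : Carrier
    +-assoc    : ∀ x y z → (x + y) + z ≡ x + (y + z)
    +-comm     : ∀ x y → x + y ≡ y + x
    +-identityˡ : ∀ x → 𝟎 + x ≡ x
    +-idem     : ∀ x → x + x ≡ x
    ·-assoc    : ∀ x y z → (x · y) · z ≡ x · (y · z)
    ·-identityˡ : ∀ x → 𝟏 · x ≡ x
    ·-identityʳ : ∀ x → x · 𝟏 ≡ x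
    zeroˡ      : ∀ x → 𝟎 · x ≡ 𝟎
    zeroʳ      : ∀ x → x · 𝟎 ≡ 𝟎
    distribˡ   : ∀ x y z → x · (y + z) ≡ (x · y) + (x · z)
    distribʳ   : ∀ x y z → (y + z) · x ≡ (y · x) + (z · x)

  _≤_ : Carrier → Carrier → Set c
  x ≤ y = x + y ≡ y

record KleeneAlgebra (c : Level) : Set (suc c) where
  field
    semiring : IdempotentSemiring c
  open IdempotentSemiring semiring public
  field
    _⋆ : Carrier → Carrier
    ⋆-unfoldˡ : ∀ x → (𝟏 + (x · (x ⋆))) ≤ (x ⋆)
    ⋆-unfoldʳ : ∀ x → (𝟏 + ((x ⋆) · x)) ≤ (x ⋆)
    ⋆-inductˡ : ∀ p q x → (p + (q · x)) ≤ x → ((q ⋆) · p) ≤ x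
    ⋆-inductʳ : ∀ p q x → (p + (x · q)) ≤ x → (p · (q ⋆)) ≤ x

-- Kleene algebra with tests: the test sort B is a set `Test` embedded
-- injectively into K by ι (so B ⊆ K), the Boolean operations on B are the
-- restrictions of +, ·, 0, 1 of K together with a complement, and
-- (B,+,·,¬,0,1) is a Boolean algebra.
record KAT (c : Level) : Set (suc c) where
  field
    KA : KleeneAlgebra c
  open KleeneAlgebra KA public
  field
    Test : Set c
    ι    : Test → Carrier
    ι-injective : Injective _≡_ _≡_ ι
    _⊕_ _⊗_ : Test → Test → Test
    ¬_   : Test → Test
    t𝟎 t𝟏 : Test
    ι-⊕ : ∀ a b → ι (a ⊕ b) ≡ ι a + ι b
    ι-⊗ : ∀ a b → ι (a ⊗ b) ≡ ι a · ι b
    ι-𝟎 : ι t𝟎 ≡ 𝟎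
    ι-𝟏 : ι t𝟏 ≡ 𝟏
    isBooleanAlgebra : LS.IsBooleanAlgebra _≡_ _⊕_ _⊗_ ¬_ t𝟏 t𝟎

module _ {c : Level} (K : KleeneAlgebra c) where
  open KleeneAlgebra K

  IsSubKA : (Carrier → Set c) → Set c
  IsSubKA S = S 𝟎 × S 𝟏
            × (∀ x y → S x → S y → S (x + y))
            × (∀ x y → S x → S y → S (x · y))
            × (∀ x → S x → S (x ⋆))

  ↓ : Carrier → Carrier → Set c
  ↓ x y = y ≤ x

module _ {c : Level} (K : KAT c) where
  open KAT K

  IsSubKAT : (Carrier → Set c) → Set c
  IsSubKAT S = IsSubKA KA S
             × S (ι t𝟎) × S (ι t𝟏)
             × (∀ a b → S (ι a) → S (ι b) → S (ι (a ⊕ b)))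
             × (∀ a b → S (ι a) → S (ι b) → S (ι (a ⊗ b)))
             × (∀ a → S (ι a) → S (ι (¬ a)))

-- Call z reflexive-transitive when 𝟏 ≤ z and z · z ≤ z. Every star y ⋆ is
-- one, and x ⋆ is the least reflexive-transitive element above x. Hence the
-- down-set of a reflexive-transitive z contains 𝟎 and 𝟏 and is closed under
-- +, · and ⋆, while every test lies below 𝟏 ≤ z, so the Boolean operations
-- stay inside as well. Conversely, if ↓ x is closed under ⋆ then x ⋆ ≤ x,
-- and x ≤ x ⋆ always, so x = x ⋆.
{-# OPTIONS --safe #-}
module Submission where

open import Defs
open import Level using (Level)
open import Data.Product using (Σ; _×_; _,_; proj₁)
open import Function.Bundles using (_⇔_; mk⇔)
open import Relation.Binary.PropositionalEquality
  using (_≡_; refl; sym; trans; cong; subst; module ≡-Reasoning)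
import Algebra.Lattice.Structures as LS

module IdempotentSemiringProperties {c : Level} (S : IdempotentSemiring c) where
  open IdempotentSemiring S

  ≤-refl : ∀ {x} → x ≤ x
  ≤-refl {x} = +-idem x

  ≤-trans : ∀ {x y z} → x ≤ y → y ≤ z → x ≤ z
  ≤-trans {x} {y} {z} x≤y y≤z = begin
    x + z         ≡⟨ cong (x +_) (sym y≤z) ⟩
    x + (y + z)   ≡⟨ sym (+-assoc x y z) ⟩
    (x + y) + z   ≡⟨ cong (_+ z) x≤y ⟩
    y + z         ≡⟨ y≤z ⟩
    z             ∎
    where open ≡-Reasoning

  ≤-antisym : ∀ {x y} → x ≤ y → y ≤ x → x ≡ y
  ≤-antisym {x} {y} x≤y y≤x = trans (sym y≤x) (trans (+-comm y x) x≤y)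

  𝟎≤x : ∀ x → 𝟎 ≤ x
  𝟎≤x = +-identityˡ

  x≤x+y : ∀ x y → x ≤ (x + y)
  x≤x+y x y = trans (sym (+-assoc x x y)) (cong (_+ y) (+-idem x))

  y≤x+y : ∀ x y → y ≤ (x + y)
  y≤x+y x y = subst (y ≤_) (+-comm y x) (x≤x+y y x)

  +-least : ∀ {x y z} → x ≤ z → y ≤ z → (x + y) ≤ z
  +-least {x} {y} {z} x≤z y≤z = trans (+-assoc x y z) (trans (cong (x +_) y≤z) x≤z)

  ·-monoˡ-≤ : ∀ {x y} z → x ≤ y → (x · z) ≤ (y · z)
  ·-monoˡ-≤ {x} {y} z x≤y = trans (sym (distribʳ z x y)) (cong (_· z) x≤y)

  ·-monoʳ-≤ : ∀ {x y} z → x ≤ y → (z · x) ≤ (z · y)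
  ·-monoʳ-≤ {x} {y} z x≤y = trans (sym (distribˡ z x y)) (cong (z ·_) x≤y)

  ·-mono-≤ : ∀ {x y u v} → x ≤ y → u ≤ v → (x · u) ≤ (y · v)
  ·-mono-≤ {y = y} {u} x≤y u≤v = ≤-trans (·-monoˡ-≤ u x≤y) (·-monoʳ-≤ y u≤v)

module KleeneAlgebraProperties {c : Level} (K : KleeneAlgebra c) where
  open KleeneAlgebra K
  open IdempotentSemiringProperties semiring

  IsStar : Carrier → Set c
  IsStar x = Σ Carrier (λ y → x ≡ y ⋆)

  𝟏≤x⋆ : ∀ x → 𝟏 ≤ (x ⋆)
  𝟏≤x⋆ x = ≤-trans (x≤x+y 𝟏 (x · x ⋆)) (⋆-unfoldˡ x)

  x·x⋆≤x⋆ : ∀ x → (x · x ⋆) ≤ (x ⋆)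
  x·x⋆≤x⋆ x = ≤-trans (y≤x+y 𝟏 (x · x ⋆)) (⋆-unfoldˡ x)

  x≤x⋆ : ∀ x → x ≤ (x ⋆)
  x≤x⋆ x = ≤-trans (subst (_≤ (x · x ⋆)) (·-identityʳ x) (·-monoʳ-≤ x (𝟏≤x⋆ x))) (x·x⋆≤x⋆ x)

  x⋆·x⋆≤x⋆ : ∀ x → (x ⋆ · x ⋆) ≤ (x ⋆)
  x⋆·x⋆≤x⋆ x = ⋆-inductˡ (x ⋆) x (x ⋆) (+-least ≤-refl (x·x⋆≤x⋆ x))

  ⋆-least : ∀ {x z} → 𝟏 ≤ z → (z · z) ≤ z → x ≤ z → (x ⋆) ≤ z
  ⋆-least {x} {z} 𝟏≤z z·z≤z x≤z = subst (_≤ z) (·-identityʳ (x ⋆))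
    (⋆-inductˡ 𝟏 x z (+-least 𝟏≤z (≤-trans (·-monoˡ-≤ z x≤z) z·z≤z)))

  ⋆-idem : ∀ x → (x ⋆) ⋆ ≡ x ⋆
  ⋆-idem x = ≤-antisym (⋆-least (𝟏≤x⋆ x) (x⋆·x⋆≤x⋆ x) ≤-refl) (x≤x⋆ (x ⋆))

  isStar⇔⋆-fixed : ∀ x → IsStar x ⇔ (x ≡ x ⋆)
  isStar⇔⋆-fixed x = mk⇔ (λ { (y , refl) → sym (⋆-idem y) }) (x ,_)

  ↓-isSubKA : ∀ {z} → 𝟏 ≤ z → (z · z) ≤ z → IsSubKA K (↓ K z)
  ↓-isSubKA {z} 𝟏≤z z·z≤z =
    𝟎≤x z , 𝟏≤z , (λ _ _ → +-least) , (λ _ _ x≤z y≤z → ≤-trans (·-mono-≤ x≤z y≤z) z·z≤z)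
    , (λ _ → ⋆-least 𝟏≤z z·z≤z)

  ↓-isSubKA⇒⋆-fixed : ∀ {x} → IsSubKA K (↓ K x) → x ≡ x ⋆
  ↓-isSubKA⇒⋆-fixed {x} (_ , _ , _ , _ , ⋆-closed) = ≤-antisym (x≤x⋆ x) (⋆-closed x ≤-refl)

  ↓-isSubKA⇔isStar : ∀ x → IsSubKA K (↓ K x) ⇔ IsStar x
  ↓-isSubKA⇔isStar x = mk⇔ (λ sub → x , ↓-isSubKA⇒⋆-fixed sub)
    (λ { (y , refl) → ↓-isSubKA (𝟏≤x⋆ y) (x⋆·x⋆≤x⋆ y) })

module KATProperties {c : Level} (K : KAT c) where
  open KAT K
  open IdempotentSemiringProperties semiring
  open KleeneAlgebraProperties KA
  open LS.IsBooleanAlgebra isBooleanAlgebra using (∨-complementʳ)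

  test≤𝟏 : ∀ a → ι a ≤ 𝟏
  test≤𝟏 a = subst (ι a ≤_) ι[a⊕¬a]≡𝟏 (x≤x+y (ι a) (ι (¬ a)))
    where
    ι[a⊕¬a]≡𝟏 : ι a + ι (¬ a) ≡ 𝟏
    ι[a⊕¬a]≡𝟏 = trans (sym (ι-⊕ a (¬ a))) (trans (cong ι (∨-complementʳ a)) ι-𝟏)

  ↓-isSubKAT : ∀ {z} → 𝟏 ≤ z → (z · z) ≤ z → IsSubKAT K (↓ KA z)
  ↓-isSubKAT {z} 𝟏≤z z·z≤z =
    ↓-isSubKA 𝟏≤z z·z≤z , below t𝟎 , below t𝟏
    , (λ a b _ _ → below (a ⊕ b)) , (λ a b _ _ → below (a ⊗ b)) , (λ a _ → below (¬ a))
    where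
    below : ∀ a → ι a ≤ z
    below a = ≤-trans (test≤𝟏 a) 𝟏≤z

  ↓-isSubKAT⇔isStar : ∀ x → IsSubKAT K (↓ KA x) ⇔ IsStar x
  ↓-isSubKAT⇔isStar x = mk⇔ (λ sub → x , ↓-isSubKA⇒⋆-fixed (proj₁ sub))
    (λ { (y , refl) → ↓-isSubKAT (𝟏≤x⋆ y) (x⋆·x⋆≤x⋆ y) })

lemma3 : ∀ {c : Level}
    → ((K : KleeneAlgebra c) → (x : KleeneAlgebra.Carrier K)
        → (IsSubKA K (↓ K x) ⇔ Σ (KleeneAlgebra.Carrier K) (λ y → x ≡ KleeneAlgebra._⋆ K y))
          × (Σ (KleeneAlgebra.Carrier K) (λ y → x ≡ KleeneAlgebra._⋆ K y) ⇔ (x ≡ KleeneAlgebra._⋆ K x)))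
    × ((K : KAT c) → (x : KAT.Carrier K)
        → (IsSubKAT K (↓ (KAT.KA K) x) ⇔ Σ (KAT.Carrier K) (λ y → x ≡ KAT._⋆ K y))
          × (Σ (KAT.Carrier K) (λ y → x ≡ KAT._⋆ K y) ⇔ (x ≡ KAT._⋆ K x)))
lemma3 =
    (λ K x → let open KleeneAlgebraProperties K in ↓-isSubKA⇔isStar x , isStar⇔⋆-fixed x)
  , (λ K x → let open KATProperties K
                 open KleeneAlgebraProperties (KAT.KA K)
             in ↓-isSubKAT⇔isStar x , isStar⇔⋆-fixed x)
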